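{- Let $m \geqslant 13$ be an odd integer. The digraph $L_{2m} = \vec{X}(m, \{1,3\}) \wr \overline{K}_2$ admits a $\vec{C}_m$-factorization if and only if $3 \nmid m$.
   Context: For $D \subseteq \{1,\ldots,m-1\}$, the directed circulant $\vec{X}(m,D)$ has vertex set $\mathbb{Z}_m$ and arcs $(a,b)$ with $b-a \in D$ (mod $m$). The wreath product $G \wr H$ of digraphs has vertex set $V(G)\times V(H)$ and an arc from $(g_1,h_1)$ to $(g_2,h_2)$ iff $(g_1,g_2)\in A(G)$, or $g_1=g_2$ and $(h_1,h_2)\in A(H)$. $\overline{K}_2$ is the digraph on two vertices with no arcs. A $\vec{C}_m$-factor of a digraph is a spanning subdigraph that is a disjoint union of directed $m$-cycles; a $\vec{C}_m$-factorization is a partition of the arc set into the arc sets of $\vec{C}_m$-factors. -}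

module Defs where

open import Data.Nat using (ℕ; zero; suc; _+_; _*_; _<_)
open import Data.Fin using (Fin; toℕ)
open import Data.Product using (Σ; _×_; _,_)
open import Data.Sum using (_⊎_)
open import Data.Empty using (⊥)
open import Relation.Binary.PropositionalEquality using (_≡_)
open import Relation.Nullary using (¬_)

Digraph : Set → Set₁
Digraph V = V → V → Set

Circulant : (m : ℕ) → (ℕ → Set) → Digraph (Fin m)
Circulant m D a b = Σ ℕ λ d → D d × Σ ℕ λ k → toℕ a + d ≡ toℕ b + k * m

Wreath : {V W : Set} → Digraph V → Digraph W → Digraph (V × W)
Wreath G H (g₁ , h₁) (g₂ , h₂) = G g₁ g₂ ⊎ (g₁ ≡ g₂ × H h₁ h₂)

K̄₂ : Digraph (Fin 2)
K̄₂ _ _ = ⊥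

D13 : ℕ → Set
D13 d = d ≡ 1 ⊎ d ≡ 3

L : (m : ℕ) → Digraph (Fin m × Fin 2)
L m = Wreath (Circulant m D13) K̄₂

iter : {V : Set} → (V → V) → ℕ → V → V
iter f zero x = x
iter f (suc n) x = f (iter f n x)

-- A spanning subdigraph that is a disjoint union of directed ℓ-cycles is encoded by
-- its successor map σ: the arcs of the factor are exactly (v , σ v).
IsCycleFactor : {V : Set} → ℕ → Digraph V → (V → V) → Set
IsCycleFactor {V} ℓ G σ =
  (∀ v → G v (σ v)) ×
  (∀ u v → σ u ≡ σ v → u ≡ v) ×
  (∀ v → iter σ ℓ v ≡ v) ×
  (∀ v i → 0 < i → i < ℓ → ¬ (iter σ i v ≡ v))

HasCycleFactorization : {V : Set} → ℕ → Digraph V → Set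
HasCycleFactorization {V} ℓ G =
  Σ ℕ λ k → Σ (Fin k → V → V) λ σ →
    (∀ t → IsCycleFactor ℓ G (σ t)) ×
    (∀ u v → G u v → Σ (Fin k) λ t → σ t u ≡ v) ×
    (∀ u t t' → σ t u ≡ σ t' u → t ≡ t')

-- Any b : ℤ_m → Fin 2, choosing a layer over each point, gives a C_m-factor:
-- step +1 from the chosen layer into the chosen layer, +3 from the other layer into the other
-- layer; both are single m-cycles since gcd(m, 3) = 1.  Take a proper 3-colouring of the graph
-- underlying X(m, {1,3}) (one exists for odd m ≥ 9) and, for (p, q) ∈ F₂², let b choose p, q or
-- p ⊻ q according to the colour of the point.  The endpoints of an arc have distinct colours, so
-- as (p, q) runs through F₂² the pair of layers chosen at the endpoints runs through F₂² exactly
-- once: the four factors partition the arcs.  After n steps a walk has moved by n + 2J(n), J(n) its number of +3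
-- steps.  Around an m-cycle m ∣ 2J(m), hence m ∣ J(m) as m is odd; so a cycle using one +3 step
-- uses only +3 steps, and its vertices after 0, m/3 and 2m/3 steps lie over the same point of
-- ℤ_m, two of them in the same layer.  But the factor containing a +3 arc has such a cycle.
module Submission where

open import Defs
open import Function using (_∘_; _↔_; Inverse)
open import Function.Bundles using (_⇔_; mk⇔)
open import Data.Nat using (ℕ; zero; suc; _+_; _*_; _∸_; _≤_; _<_; NonZero; z≤n; s≤s; s≤s⁻¹; >-nonZero; pred)
open import Data.Nat.Properties hiding (_≟_)
open import Data.Nat.DivMod using (_%_; _/_; _mod_; m%n<n; m<n⇒m%n≡m; m≡m%n+[m/n]*n; %-distribˡ-+; m%n%n≡m%n; %-remove-+ʳ; [m+n]%n≡m%n)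
open import Data.Nat.Divisibility using (_∣_; divides; ∣⇒≤; ∣-refl; ∣1⇒≡1; n∣m*n; ∣m∣n⇒∣m+n; ∣m+n∣m⇒∣n)
open import Data.Nat.Coprimality using (Coprime; coprime-divisor)
open import Data.Nat.Primality using (Prime; prime?; prime[2]; prime⇒irreducible)
open import Data.Nat.Solver using (module +-*-Solver)
open import Data.Fin using (Fin; toℕ; opposite; _≟_)
open import Data.Fin.Patterns using (0F; 1F; 2F)
open import Data.Fin.Properties using (toℕ-fromℕ<; toℕ-injective; toℕ<n; opposite-involutive; *↔×; pigeonhole)
open import Data.Product using (Σ; _×_; _,_; proj₁; proj₂)
open import Data.Sum using (_⊎_; inj₁; inj₂)
open import Data.Empty using (⊥-elim)
open import Relation.Nullary using (¬_; yes; no; contradiction)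
open import Relation.Nullary.Decidable using (from-yes)
open import Relation.Binary.PropositionalEquality

open +-*-Solver using (solve; _:+_; _:*_; _:=_; con)

iter-+ : {V : Set} (f : V → V) (i j : ℕ) (v : V) → iter f (i + j) v ≡ iter f i (iter f j v)
iter-+ f zero    j v = refl
iter-+ f (suc i) j v = cong f (iter-+ f i j v)

cycleFactor-iter-distinct : {V : Set} {ℓ : ℕ} {G : Digraph V} {σ : V → V} →
  IsCycleFactor ℓ G σ → ∀ v {i j} → i < j → j < ℓ → iter σ i v ≢ iter σ j v
cycleFactor-iter-distinct {σ = σ} (_ , _ , _ , aperiodic) v {i} {j} i<j j<ℓ eq =
  aperiodic (iter σ i v) (j ∸ i) (m<n⇒0<n∸m i<j) (≤-<-trans (m∸n≤m j i) j<ℓ) (begin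
    iter σ (j ∸ i) (iter σ i v) ≡⟨ iter-+ σ (j ∸ i) i v ⟨
    iter σ (j ∸ i + i) v        ≡⟨ cong (λ n → iter σ n v) (m∸n+n≡m (<⇒≤ i<j)) ⟩
    iter σ j v                  ≡⟨ eq ⟨
    iter σ i v                  ∎)
  where open ≡-Reasoning

cycleFactorization-↔ : {V I : Set} {ℓ k : ℕ} {G : Digraph V} → Fin k ↔ I →
  (σ : I → V → V) → (∀ t → IsCycleFactor ℓ G (σ t)) →
  (∀ u v → G u v → Σ I λ t → σ t u ≡ v) →
  (∀ u t t' → σ t u ≡ σ t' u → t ≡ t') →
  HasCycleFactorization ℓ G
cycleFactorization-↔ {k = k} {G = G} Fin↔I σ factor cover unique =
  k , σ ∘ to , factor ∘ to , cover′ , unique′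
  where
  open Inverse Fin↔I
  cover′ : ∀ u v → G u v → Σ (Fin k) λ t → σ (to t) u ≡ v
  cover′ u v uv with cover u v uv
  ... | t , eq = from t , trans (cong (λ s → σ s u) (strictlyInverseˡ t)) eq
  unique′ : ∀ u t t' → σ (to t) u ≡ σ (to t') u → t ≡ t'
  unique′ u t t' eq = begin
    t           ≡⟨ strictlyInverseʳ t ⟨
    from (to t)  ≡⟨ cong from (unique u (to t) (to t') eq) ⟩
    from (to t') ≡⟨ strictlyInverseʳ t' ⟩
    t'           ∎
    where open ≡-Reasoning

prime∤⇒coprime : ∀ {p n} → Prime p → ¬ p ∣ n → Coprime n p
prime∤⇒coprime pr p∤n (d∣n , d∣p) with prime⇒irreducible pr d∣p
... | inj₁ d≡1 = d≡1
... | inj₂ refl = contradiction d∣n p∤n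

prime[3] : Prime 3
prime[3] = from-yes (prime? 3)

9+k-odd⇒k-even : ∀ k → ¬ 2 ∣ 9 + k → Σ ℕ λ j → k ≡ 2 * j
9+k-odd⇒k-even zero          _   = 0 , refl
9+k-odd⇒k-even (suc zero)    2∤  = contradiction (divides 5 refl) 2∤
9+k-odd⇒k-even (suc (suc k)) 2∤ with 9+k-odd⇒k-even k (2∤ ∘ ∣m∣n⇒∣m+n ∣-refl)
... | j , refl = suc j , sym (*-suc 2 j)

odd⇒≡9+2* : ∀ {m} → 9 ≤ m → ¬ 2 ∣ m → Σ ℕ λ j → m ≡ 9 + 2 * j
odd⇒≡9+2* {m} 9≤m 2∤m =
  let (j , m∸9≡2j) = 9+k-odd⇒k-even (m ∸ 9) (2∤m ∘ subst (2 ∣_) (m+[n∸m]≡n 9≤m))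
  in j , trans (sym (m+[n∸m]≡n 9≤m)) (cong (9 +_) m∸9≡2j)

∑< : (ℕ → ℕ) → ℕ → ℕ
∑< f zero    = 0
∑< f (suc n) = ∑< f n + f n

∑<-mono : ∀ f n r → ∑< f n ≤ ∑< f (r + n)
∑<-mono f n zero    = ≤-refl
∑<-mono f n (suc r) = ≤-trans (∑<-mono f n r) (m≤m+n _ _)

module _ {f : ℕ → ℕ} (f≤1 : ∀ i → f i ≤ 1) where

  ∑<-≤ : ∀ n → ∑< f n ≤ n
  ∑<-≤ zero    = z≤n
  ∑<-≤ (suc n) = subst (∑< f n + f n ≤_) (+-comm n 1) (+-mono-≤ (∑<-≤ n) (f≤1 n))

  ∑<-saturated-pred : ∀ n → ∑< f (suc n) ≡ suc n → ∑< f n ≡ n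
  ∑<-saturated-pred n eq = ≤-antisym (∑<-≤ n) (s≤s⁻¹ (begin
    suc n         ≡⟨ eq ⟨
    ∑< f n + f n  ≤⟨ +-monoʳ-≤ (∑< f n) (f≤1 n) ⟩
    ∑< f n + 1    ≡⟨ +-comm (∑< f n) 1 ⟩
    suc (∑< f n)  ∎))
    where open ≤-Reasoning

  ∑<-saturated : ∀ r n → ∑< f (r + n) ≡ r + n → ∑< f n ≡ n
  ∑<-saturated zero    n eq = eq
  ∑<-saturated (suc r) n eq = ∑<-saturated r n (∑<-saturated-pred (r + n) eq)

opposite-≢ : (x : Fin 2) → opposite x ≢ x
opposite-≢ 0F ()
opposite-≢ 1F ()

≡⊎≡opposite : (x y : Fin 2) → x ≡ y ⊎ x ≡ opposite y
≡⊎≡opposite 0F 0F = inj₁ refl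
≡⊎≡opposite 0F 1F = inj₂ refl
≡⊎≡opposite 1F 0F = inj₂ refl
≡⊎≡opposite 1F 1F = inj₁ refl

opposite-injective : {x y : Fin 2} → opposite x ≡ opposite y → x ≡ y
opposite-injective {x} {y} eq =
  trans (sym (opposite-involutive x)) (trans (cong opposite eq) (opposite-involutive y))

infixl 6 _⊻_
_⊻_ : Fin 2 → Fin 2 → Fin 2
0F ⊻ y = y
1F ⊻ y = opposite y

⊻-comm : ∀ x y → x ⊻ y ≡ y ⊻ x
⊻-comm 0F 0F = refl
⊻-comm 0F 1F = refl
⊻-comm 1F 0F = refl
⊻-comm 1F 1F = refl

⊻-selfInverse : ∀ x y → x ⊻ (x ⊻ y) ≡ y
⊻-selfInverse 0F y = refl
⊻-selfInverse 1F y = opposite-involutive y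

⊻-cancelˡ : ∀ x {y z} → x ⊻ y ≡ x ⊻ z → y ≡ z
⊻-cancelˡ x {y} {z} eq = trans (sym (⊻-selfInverse x y)) (trans (cong (x ⊻_) eq) (⊻-selfInverse x z))

⊻-cancelʳ : ∀ {x y} z → x ⊻ z ≡ y ⊻ z → x ≡ y
⊻-cancelʳ {x} {y} z eq = ⊻-cancelˡ z (trans (⊻-comm z x) (trans eq (⊻-comm y z)))

-- The three nonzero linear functionals on F₂² = Fin 2 × Fin 2; any two of them are independent.
bit : Fin 3 → Fin 2 × Fin 2 → Fin 2
bit 0F (p , q) = p
bit 1F (p , q) = q
bit 2F (p , q) = p ⊻ q

bit-pair-surjective : ∀ c c' → c ≢ c' → ∀ x y → Σ (Fin 2 × Fin 2) λ t → bit c t ≡ x × bit c' t ≡ y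
bit-pair-surjective 0F 0F c≢c' _ _ = contradiction refl c≢c'
bit-pair-surjective 1F 1F c≢c' _ _ = contradiction refl c≢c'
bit-pair-surjective 2F 2F c≢c' _ _ = contradiction refl c≢c'
bit-pair-surjective 0F 1F _ x y = (x , y) , refl , refl
bit-pair-surjective 1F 0F _ x y = (y , x) , refl , refl
bit-pair-surjective 0F 2F _ x y = (x , x ⊻ y) , refl , ⊻-selfInverse x y
bit-pair-surjective 2F 0F _ x y = (y , y ⊻ x) , ⊻-selfInverse y x , refl
bit-pair-surjective 1F 2F _ x y = (x ⊻ y , x) , refl , trans (⊻-comm (x ⊻ y) x) (⊻-selfInverse x y)
bit-pair-surjective 2F 1F _ x y = (y ⊻ x , y) , trans (⊻-comm (y ⊻ x) y) (⊻-selfInverse y x) , refl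

bit-pair-injective : ∀ c c' → c ≢ c' → ∀ {t t'} → bit c t ≡ bit c t' → bit c' t ≡ bit c' t' → t ≡ t'
bit-pair-injective 0F 0F c≢c' _ _ = contradiction refl c≢c'
bit-pair-injective 1F 1F c≢c' _ _ = contradiction refl c≢c'
bit-pair-injective 2F 2F c≢c' _ _ = contradiction refl c≢c'
bit-pair-injective 0F 1F _ e e' = cong₂ _,_ e e'
bit-pair-injective 1F 0F _ e e' = cong₂ _,_ e' e
bit-pair-injective 0F 2F _ e e' = first-and-sum e e'
  where
  first-and-sum : ∀ {p q p' q'} → p ≡ p' → p ⊻ q ≡ p' ⊻ q' → (p , q) ≡ (p' , q')
  first-and-sum {p} {q} {p'} {q'} refl e' = cong (p ,_) (⊻-cancelˡ p e')
bit-pair-injective 2F 0F _ e e' = bit-pair-injective 0F 2F (λ ()) e' e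
bit-pair-injective 1F 2F _ e e' = second-and-sum e e'
  where
  second-and-sum : ∀ {p q p' q'} → q ≡ q' → p ⊻ q ≡ p' ⊻ q' → (p , q) ≡ (p' , q')
  second-and-sum {p} {q} refl e' = cong (_, q) (⊻-cancelʳ q e')
bit-pair-injective 2F 1F _ e e' = bit-pair-injective 1F 2F (λ ()) e' e

D13-jump : ∀ {d} → D13 d → ℕ
D13-jump (inj₁ _) = 0
D13-jump (inj₂ _) = 1

D13-jump≤1 : ∀ {d} (d∈D : D13 d) → D13-jump d∈D ≤ 1
D13-jump≤1 (inj₁ _) = z≤n
D13-jump≤1 (inj₂ _) = s≤s z≤n

D13-odd : ∀ {d} (d∈D : D13 d) → d ≡ 1 + 2 * D13-jump d∈D
D13-odd (inj₁ refl) = refl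
D13-odd (inj₂ refl) = refl

module _ {m : ℕ} .{{_ : NonZero m}} where

  infixl 6 _⊕_
  _⊕_ : Fin m → ℕ → Fin m
  a ⊕ k = (toℕ a + k) mod m

  toℕ-⊕ : ∀ a k → toℕ (a ⊕ k) ≡ (toℕ a + k) % m
  toℕ-⊕ a k = toℕ-fromℕ< (m%n<n (toℕ a + k) m)

  ⊕-identityʳ : ∀ a → a ⊕ 0 ≡ a
  ⊕-identityʳ a = toℕ-injective (begin
    toℕ (a ⊕ 0)      ≡⟨ toℕ-⊕ a 0 ⟩
    (toℕ a + 0) % m  ≡⟨ cong (_% m) (+-identityʳ (toℕ a)) ⟩
    toℕ a % m        ≡⟨ m<n⇒m%n≡m (toℕ<n a) ⟩
    toℕ a            ∎)
    where open ≡-Reasoning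

  ⊕-assoc : ∀ a k l → a ⊕ k ⊕ l ≡ a ⊕ (k + l)
  ⊕-assoc a k l = toℕ-injective (begin
    toℕ (a ⊕ k ⊕ l)                 ≡⟨ toℕ-⊕ (a ⊕ k) l ⟩
    (toℕ (a ⊕ k) + l) % m           ≡⟨ cong (λ x → (x + l) % m) (toℕ-⊕ a k) ⟩
    ((toℕ a + k) % m + l) % m       ≡⟨ %-distribˡ-+ ((toℕ a + k) % m) l m ⟩
    ((toℕ a + k) % m % m + l % m) % m ≡⟨ cong (λ x → (x + l % m) % m) (m%n%n≡m%n (toℕ a + k) m) ⟩
    ((toℕ a + k) % m + l % m) % m   ≡⟨ %-distribˡ-+ (toℕ a + k) l m ⟨
    (toℕ a + k + l) % m             ≡⟨ cong (_% m) (+-assoc (toℕ a) k l) ⟩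
    (toℕ a + (k + l)) % m           ≡⟨ toℕ-⊕ a (k + l) ⟨
    toℕ (a ⊕ (k + l))               ∎)
    where open ≡-Reasoning

  ⊕-period : ∀ a {k} → m ∣ k → a ⊕ k ≡ a
  ⊕-period a {k} m∣k = toℕ-injective (begin
    toℕ (a ⊕ k)      ≡⟨ toℕ-⊕ a k ⟩
    (toℕ a + k) % m  ≡⟨ %-remove-+ʳ (toℕ a) m∣k ⟩
    toℕ a % m        ≡⟨ m<n⇒m%n≡m (toℕ<n a) ⟩
    toℕ a            ∎)
    where open ≡-Reasoning

  ⊕-fixed⇒∣ : ∀ a k → a ⊕ k ≡ a → m ∣ k
  ⊕-fixed⇒∣ a k eq = divides ((toℕ a + k) / m) (+-cancelˡ-≡ (toℕ a) k _ (begin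
    toℕ a + k                              ≡⟨ m≡m%n+[m/n]*n (toℕ a + k) m ⟩
    (toℕ a + k) % m + (toℕ a + k) / m * m  ≡⟨ cong (_+ (toℕ a + k) / m * m) (trans (sym (toℕ-⊕ a k)) (cong toℕ eq)) ⟩
    toℕ a + (toℕ a + k) / m * m            ∎))
    where open ≡-Reasoning

  ⊕-cancelʳ : ∀ {a b} k → a ⊕ k ≡ b ⊕ k → a ≡ b
  ⊕-cancelʳ {a} {b} k eq = trans (sym (undo a)) (trans (cong (_⊕ k * pred m) eq) (undo b))
    where
    undo : ∀ c → c ⊕ k ⊕ k * pred m ≡ c
    undo c = begin
      c ⊕ k ⊕ k * pred m      ≡⟨ ⊕-assoc c k (k * pred m) ⟩
      c ⊕ (k + k * pred m)    ≡⟨ cong (c ⊕_) (*-suc k (pred m)) ⟨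
      c ⊕ k * suc (pred m)    ≡⟨ cong (λ n → c ⊕ k * n) (suc-pred m) ⟩
      c ⊕ k * m               ≡⟨ ⊕-period c (n∣m*n k) ⟩
      c                       ∎
      where open ≡-Reasoning

  -- toℕ a + suc e ≡ m says that a lies e positions before the end of 0, 1, …, m - 1.
  ⊕-within : ∀ a d e → toℕ a + suc (d + e) ≡ m → toℕ (a ⊕ d) + suc e ≡ m
  ⊕-within a d e gap = begin
    toℕ (a ⊕ d) + suc e    ≡⟨ cong (_+ suc e) (trans (toℕ-⊕ a d) (m<n⇒m%n≡m a+d<m)) ⟩
    toℕ a + d + suc e      ≡⟨ +-assoc (toℕ a) d (suc e) ⟩
    toℕ a + (d + suc e)    ≡⟨ cong (toℕ a +_) (+-suc d e) ⟩
    toℕ a + suc (d + e)    ≡⟨ gap ⟩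
    m                      ∎
    where
    open ≡-Reasoning
    a+d<m : toℕ a + d < m
    a+d<m = subst (toℕ a + d <_) gap (+-monoʳ-< (toℕ a) (s≤s (m≤m+n d e)))

  ⊕-across : ∀ a e r → toℕ a + suc e ≡ m → r < m → toℕ (a ⊕ (suc e + r)) ≡ r
  ⊕-across a e r gap r<m = begin
    toℕ (a ⊕ (suc e + r))      ≡⟨ toℕ-⊕ a (suc e + r) ⟩
    (toℕ a + (suc e + r)) % m  ≡⟨ cong (_% m) (+-assoc (toℕ a) (suc e) r) ⟨
    (toℕ a + suc e + r) % m    ≡⟨ cong (λ k → (k + r) % m) gap ⟩
    (m + r) % m                ≡⟨ cong (_% m) (+-comm m r) ⟩
    (r + m) % m                ≡⟨ [m+n]%n≡m%n r m ⟩
    r % m                      ≡⟨ m<n⇒m%n≡m r<m ⟩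
    r                          ∎
    where open ≡-Reasoning

  ⊕1≢⊕3 : 2 < m → ∀ a → a ⊕ 1 ≢ a ⊕ 3
  ⊕1≢⊕3 2<m a eq = <⇒≱ 2<m (∣⇒≤ (⊕-fixed⇒∣ (a ⊕ 1) 2 (trans (⊕-assoc a 1 2) (sym eq))))

  L-arc : ∀ u v → L m u v → Σ ℕ λ d → D13 d × proj₁ v ≡ proj₁ u ⊕ d
  L-arc (a , _) (b , _) (inj₁ (d , d∈D , k , eq)) = d , d∈D , toℕ-injective (sym (begin
    toℕ (a ⊕ d)          ≡⟨ toℕ-⊕ a d ⟩
    (toℕ a + d) % m      ≡⟨ cong (_% m) eq ⟩
    (toℕ b + k * m) % m  ≡⟨ %-remove-+ʳ (toℕ b) (n∣m*n k) ⟩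
    toℕ b % m            ≡⟨ m<n⇒m%n≡m (toℕ<n b) ⟩
    toℕ b                ∎))
    where open ≡-Reasoning
  L-arc _ _ (inj₂ (_ , ()))

  ⊕-L-arc : ∀ {d} → D13 d → ∀ a x y → L m (a , x) (a ⊕ d , y)
  ⊕-L-arc {d} d∈D a x y = inj₁ (d , d∈D , (toℕ a + d) / m ,
    trans (m≡m%n+[m/n]*n (toℕ a + d) m) (cong (_+ (toℕ a + d) / m * m) (sym (toℕ-⊕ a d))))

  module _ {X : Set} (σ : Fin m × X → Fin m × X) (f : Fin m → X) (s : ℕ)
           (shift : ∀ a → σ (a , f a) ≡ (a ⊕ s , f (a ⊕ s))) where

    iter-shift : ∀ n a → iter σ n (a , f a) ≡ (a ⊕ s * n , f (a ⊕ s * n))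
    iter-shift zero    a = cong (λ c → c , f c) (sym (trans (cong (a ⊕_) (*-zeroʳ s)) (⊕-identityʳ a)))
    iter-shift (suc n) a = begin
      σ (iter σ n (a , f a))                     ≡⟨ cong σ (iter-shift n a) ⟩
      σ (a ⊕ s * n , f (a ⊕ s * n))               ≡⟨ shift (a ⊕ s * n) ⟩
      (a ⊕ s * n ⊕ s , f (a ⊕ s * n ⊕ s))         ≡⟨ cong (λ c → c , f c) (⊕-assoc a (s * n) s) ⟩
      (a ⊕ (s * n + s) , f (a ⊕ (s * n + s)))     ≡⟨ cong (λ k → a ⊕ k , f (a ⊕ k)) s*n+s≡s*[1+n] ⟩
      (a ⊕ s * suc n , f (a ⊕ s * suc n))         ∎
      where
      open ≡-Reasoning
      s*n+s≡s*[1+n] : s * n + s ≡ s * suc n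
      s*n+s≡s*[1+n] = trans (+-comm (s * n) s) (sym (*-suc s n))

    iter-shift-period : ∀ a → iter σ m (a , f a) ≡ (a , f a)
    iter-shift-period a = trans (iter-shift m a) (cong (λ c → c , f c) (⊕-period a (n∣m*n s)))

    iter-shift-aperiodic : Coprime m s → ∀ a i → 0 < i → i < m → iter σ i (a , f a) ≢ (a , f a)
    iter-shift-aperiodic coprime a i 0<i i<m eq =
      <⇒≱ i<m (∣⇒≤ {{>-nonZero 0<i}} (coprime-divisor coprime (⊕-fixed⇒∣ a (s * i)
        (cong proj₁ (trans (sym (iter-shift i a)) eq)))))

  module _ (b : Fin m → Fin 2) where

    layerFactor : Fin m × Fin 2 → Fin m × Fin 2
    layerFactor (a , x) with x ≟ b a
    ... | yes _ = a ⊕ 1 , b (a ⊕ 1)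
    ... | no  _ = a ⊕ 3 , opposite (b (a ⊕ 3))

    layerFactor-on : ∀ {a x} → x ≡ b a → layerFactor (a , x) ≡ (a ⊕ 1 , b (a ⊕ 1))
    layerFactor-on {a} {x} x≡ba with x ≟ b a
    ... | yes _    = refl
    ... | no x≢ba = contradiction x≡ba x≢ba

    layerFactor-off : ∀ {a x} → x ≡ opposite (b a) → layerFactor (a , x) ≡ (a ⊕ 3 , opposite (b (a ⊕ 3)))
    layerFactor-off {a} {x} x≡b̄a with x ≟ b a
    ... | yes x≡ba = contradiction (trans (sym x≡b̄a) x≡ba) (opposite-≢ (b a))
    ... | no _     = refl

    on-image≢off-image : ∀ a a' → (a ⊕ 1 , b (a ⊕ 1)) ≢ (a' ⊕ 3 , opposite (b (a' ⊕ 3)))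
    on-image≢off-image a a' eq = opposite-≢ (b (a' ⊕ 3)) (trans (sym (cong proj₂ eq)) (cong (b ∘ proj₁) eq))

    layerFactor-injective : ∀ u v → layerFactor u ≡ layerFactor v → u ≡ v
    layerFactor-injective (a , x) (a' , x') eq
      with ≡⊎≡opposite x (b a) | ≡⊎≡opposite x' (b a')
    ... | inj₁ refl | inj₁ refl =
      cong (λ c → c , b c) (⊕-cancelʳ 1 (cong proj₁ (trans (sym (layerFactor-on refl)) (trans eq (layerFactor-on refl)))))
    ... | inj₂ refl | inj₂ refl =
      cong (λ c → c , opposite (b c)) (⊕-cancelʳ 3 (cong proj₁ (trans (sym (layerFactor-off refl)) (trans eq (layerFactor-off refl)))))
    ... | inj₁ refl | inj₂ refl =
      ⊥-elim (on-image≢off-image a a' (trans (sym (layerFactor-on refl)) (trans eq (layerFactor-off refl))))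
    ... | inj₂ refl | inj₁ refl =
      ⊥-elim (on-image≢off-image a' a (trans (sym (layerFactor-on refl)) (trans (sym eq) (layerFactor-off refl))))

    layerFactor-arc : ∀ v → L m v (layerFactor v)
    layerFactor-arc (a , x) with ≡⊎≡opposite x (b a)
    ... | inj₁ x≡ba = subst (L m (a , x)) (sym (layerFactor-on x≡ba)) (⊕-L-arc (inj₁ refl) a x (b (a ⊕ 1)))
    ... | inj₂ x≡b̄a = subst (L m (a , x)) (sym (layerFactor-off x≡b̄a)) (⊕-L-arc (inj₂ refl) a x (opposite (b (a ⊕ 3))))

    layerFactor-isCycleFactor : Coprime m 3 → IsCycleFactor m (L m) layerFactor
    layerFactor-isCycleFactor coprime = layerFactor-arc , layerFactor-injective , period , aperiodic
      where
      on-shift : ∀ a → layerFactor (a , b a) ≡ (a ⊕ 1 , b (a ⊕ 1))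
      on-shift a = layerFactor-on refl
      off-shift : ∀ a → layerFactor (a , opposite (b a)) ≡ (a ⊕ 3 , opposite (b (a ⊕ 3)))
      off-shift a = layerFactor-off refl
      period : ∀ v → iter layerFactor m v ≡ v
      period (a , x) with ≡⊎≡opposite x (b a)
      ... | inj₁ refl = iter-shift-period layerFactor b 1 on-shift a
      ... | inj₂ refl = iter-shift-period layerFactor (opposite ∘ b) 3 off-shift a
      aperiodic : ∀ v i → 0 < i → i < m → iter layerFactor i v ≢ v
      aperiodic (a , x) with ≡⊎≡opposite x (b a)
      ... | inj₁ refl = iter-shift-aperiodic layerFactor b 1 on-shift (λ (_ , d∣1) → ∣1⇒≡1 d∣1) a
      ... | inj₂ refl = iter-shift-aperiodic layerFactor (opposite ∘ b) 3 off-shift coprime a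

  ProperColouring : (Fin m → Fin 3) → Set
  ProperColouring col = ∀ a {d} → D13 d → col a ≢ col (a ⊕ d)

  module _ (col : Fin m → Fin 3) (proper : ProperColouring col) where

    colourFactor : Fin 2 × Fin 2 → Fin m × Fin 2 → Fin m × Fin 2
    colourFactor t = layerFactor (λ a → bit (col a) t)

    colourFactor-cover : ∀ u v → L m u v → Σ (Fin 2 × Fin 2) λ t → colourFactor t u ≡ v
    colourFactor-cover (a , x) (b , y) uv with L-arc (a , x) (b , y) uv
    ... | _ , inj₁ refl , refl with bit-pair-surjective (col a) (col (a ⊕ 1)) (proper a (inj₁ refl)) x y
    ...   | t , on , next = t , trans (layerFactor-on _ (sym on)) (cong (a ⊕ 1 ,_) next)
    colourFactor-cover (a , x) (b , y) uv | _ , inj₂ refl , refl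
      with bit-pair-surjective (col a) (col (a ⊕ 3)) (proper a (inj₂ refl)) (opposite x) (opposite y)
    ...   | t , off , next = t , trans (layerFactor-off _ x≡off) (cong (a ⊕ 3 ,_) y≡next)
      where
      x≡off : x ≡ opposite (bit (col a) t)
      x≡off = trans (sym (opposite-involutive x)) (cong opposite (sym off))
      y≡next : opposite (bit (col (a ⊕ 3)) t) ≡ y
      y≡next = trans (cong opposite next) (opposite-involutive y)

    colourFactor-unique : 2 < m → ∀ u t t' → colourFactor t u ≡ colourFactor t' u → t ≡ t'
    colourFactor-unique 2<m (a , x) t t' eq
      with ≡⊎≡opposite x (bit (col a) t) | ≡⊎≡opposite x (bit (col a) t')
    ... | inj₁ on | inj₁ on' =
      bit-pair-injective (col a) (col (a ⊕ 1)) (proper a (inj₁ refl)) (trans (sym on) on')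
        (cong proj₂ (trans (sym (layerFactor-on _ on)) (trans eq (layerFactor-on _ on'))))
    ... | inj₂ off | inj₂ off' =
      bit-pair-injective (col a) (col (a ⊕ 3)) (proper a (inj₂ refl)) (opposite-injective (trans (sym off) off'))
        (opposite-injective (cong proj₂ (trans (sym (layerFactor-off _ off)) (trans eq (layerFactor-off _ off')))))
    ... | inj₁ on | inj₂ off' =
      contradiction (cong proj₁ (trans (sym (layerFactor-on _ on)) (trans eq (layerFactor-off _ off')))) (⊕1≢⊕3 2<m a)
    ... | inj₂ off | inj₁ on' =
      contradiction (cong proj₁ (trans (sym (layerFactor-on _ on')) (trans (sym eq) (layerFactor-off _ off)))) (⊕1≢⊕3 2<m a)

    colouring⇒factorization : 2 < m → Coprime m 3 → HasCycleFactorization m (L m)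
    colouring⇒factorization 2<m coprime = cycleFactorization-↔ (*↔× {2} {2}) colourFactor
      (λ t → layerFactor-isCycleFactor _ coprime) colourFactor-cover (colourFactor-unique 2<m)

  ⊕3-jump : 2 < m → ∀ a {d} (d∈D : D13 d) → a ⊕ d ≡ a ⊕ 3 → D13-jump d∈D ≡ 1
  ⊕3-jump 2<m a (inj₁ refl) eq = contradiction eq (⊕1≢⊕3 2<m a)
  ⊕3-jump 2<m a (inj₂ refl) _  = refl

  module _ {S : Fin m × Fin 2 → Fin m × Fin 2} (factor : IsCycleFactor m (L m) S) (v : Fin m × Fin 2) where

    private
      arc : ∀ n → L m (iter S n v) (S (iter S n v))
      arc n = proj₁ factor (iter S n v)

      step : ∀ n → Σ ℕ λ d → D13 d × proj₁ (S (iter S n v)) ≡ proj₁ (iter S n v) ⊕ d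
      step n = L-arc (iter S n v) (S (iter S n v)) (arc n)

    jump : ℕ → ℕ
    jump n = D13-jump (proj₁ (proj₂ (step n)))

    jumps : ℕ → ℕ
    jumps = ∑< jump

    jump≤1 : ∀ n → jump n ≤ 1
    jump≤1 n = D13-jump≤1 (proj₁ (proj₂ (step n)))

    position : ∀ n → proj₁ (iter S n v) ≡ proj₁ v ⊕ (n + 2 * jumps n)
    position zero    = sym (⊕-identityʳ (proj₁ v))
    position (suc n) = begin
      proj₁ (S (iter S n v))                          ≡⟨ next ⟩
      proj₁ (iter S n v) ⊕ d                          ≡⟨ cong (_⊕ d) (position n) ⟩
      proj₁ v ⊕ (n + 2 * jumps n) ⊕ d                 ≡⟨ ⊕-assoc (proj₁ v) _ d ⟩
      proj₁ v ⊕ (n + 2 * jumps n + d)                 ≡⟨ cong (λ k → proj₁ v ⊕ (n + 2 * jumps n + k)) (D13-odd d∈D) ⟩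
      proj₁ v ⊕ (n + 2 * jumps n + (1 + 2 * jump n))  ≡⟨ cong (proj₁ v ⊕_) (regroup n (jumps n) (jump n)) ⟩
      proj₁ v ⊕ (suc n + 2 * jumps (suc n))           ∎
      where
      open ≡-Reasoning
      d : ℕ
      d = proj₁ (step n)
      d∈D : D13 d
      d∈D = proj₁ (proj₂ (step n))
      next : proj₁ (S (iter S n v)) ≡ proj₁ (iter S n v) ⊕ d
      next = proj₂ (proj₂ (step n))
      regroup : ∀ n J e → n + 2 * J + (1 + 2 * e) ≡ suc n + 2 * (J + e)
      regroup = solve 3 (λ n J e → n :+ con 2 :* J :+ (con 1 :+ con 2 :* e) := con 1 :+ n :+ con 2 :* (J :+ e)) refl

    jumps-period : Coprime m 2 → m ∣ jumps m
    jumps-period coprime = coprime-divisor coprime (∣m+n∣m⇒∣n m∣m+2J ∣-refl)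
      where
      m∣m+2J : m ∣ m + 2 * jumps m
      m∣m+2J = ⊕-fixed⇒∣ (proj₁ v) _ (sym (trans (cong proj₁ (sym (proj₁ (proj₂ (proj₂ factor)) v))) (position m)))

    every-step-jumps : 2 < m → Coprime m 2 → proj₁ (S v) ≡ proj₁ v ⊕ 3 → ∀ n → n ≤ m → jumps n ≡ n
    every-step-jumps 2<m coprime first n n≤m =
      ∑<-saturated jump≤1 (m ∸ n) n (subst (λ k → jumps k ≡ k) (sym (m∸n+n≡m n≤m)) jumps-m)
      where
      first-jump : jump 0 ≡ 1
      first-jump = ⊕3-jump 2<m (proj₁ v) (proj₁ (proj₂ (step 0))) (trans (sym (proj₂ (proj₂ (step 0)))) first)
      0<jumps-m : 0 < jumps m
      0<jumps-m = begin
        1                    ≡⟨ first-jump ⟨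
        jumps 1              ≤⟨ ∑<-mono jump 1 (m ∸ 1) ⟩
        jumps (m ∸ 1 + 1)    ≡⟨ cong jumps (m∸n+n≡m (≤-<-trans z≤n 2<m)) ⟩
        jumps m              ∎
        where open ≤-Reasoning
      jumps-m : jumps m ≡ m
      jumps-m = ≤-antisym (∑<-≤ jump≤1 m) (∣⇒≤ {{>-nonZero 0<jumps-m}} (jumps-period coprime))

  cycleFactor-no+3 : 2 < m → Coprime m 2 → 3 ∣ m →
    ∀ {S} → IsCycleFactor m (L m) S → ∀ v → proj₁ (S v) ≢ proj₁ v ⊕ 3
  cycleFactor-no+3 2<m coprime (divides zero m≡0) _ _ _ = contradiction (subst (2 <_) m≡0 2<m) λ ()
  cycleFactor-no+3 2<m coprime (divides q@(suc _) m≡q*3) {S} factor v first =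
    let (i , j , i<j , same-layer) = pigeonhole ≤-refl layer
    in cycleFactor-iter-distinct {G = L m} factor v (*-monoˡ-< q i<j) (k*q<m j)
         (cong₂ _,_ (trans (back-to-start i) (sym (back-to-start j))) same-layer)
    where
    k*q<m : (k : Fin 3) → toℕ k * q < m
    k*q<m k = subst (toℕ k * q <_) (trans (*-comm 3 q) (sym m≡q*3)) (*-monoˡ-< q (toℕ<n k))

    -- All steps are +3 steps, and k · (m / 3) of them add up to a multiple of m.
    back-to-start : (k : Fin 3) → proj₁ (iter S (toℕ k * q) v) ≡ proj₁ v
    back-to-start k = begin
      proj₁ (iter S n v)                           ≡⟨ position factor v n ⟩
      proj₁ v ⊕ (n + 2 * jumps factor v n)         ≡⟨ cong (λ J → proj₁ v ⊕ (n + 2 * J)) all-jumps ⟩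
      proj₁ v ⊕ (n + 2 * n)                        ≡⟨ cong (proj₁ v ⊕_) (trans (thrice (toℕ k) q) (cong (toℕ k *_) (sym m≡q*3))) ⟩
      proj₁ v ⊕ toℕ k * m                          ≡⟨ ⊕-period (proj₁ v) (n∣m*n (toℕ k)) ⟩
      proj₁ v                                      ∎
      where
      open ≡-Reasoning
      n : ℕ
      n = toℕ k * q
      all-jumps : jumps factor v n ≡ n
      all-jumps = every-step-jumps factor v 2<m coprime first n (<⇒≤ (k*q<m k))
      thrice : ∀ k q → k * q + 2 * (k * q) ≡ k * (q * 3)
      thrice = solve 2 (λ k q → k :* q :+ con 2 :* (k :* q) := k :* (q :* con 3)) refl

    layer : Fin 3 → Fin 2
    layer k = proj₂ (iter S (toℕ k * q) v)

  3∣⇒¬factorization : 2 < m → Coprime m 2 → 3 ∣ m → ¬ HasCycleFactorization m (L m)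
  3∣⇒¬factorization 2<m coprime 3∣m (_ , σ , factor , cover , _) =
    let (t , σt-a→a⊕3) = cover (a , 0F) (a ⊕ 3 , 0F) (⊕-L-arc (inj₂ refl) a 0F 0F)
    in cycleFactor-no+3 2<m coprime 3∣m (factor t) (a , 0F) (cong proj₁ σt-a→a⊕3)
    where
    a : Fin m
    a = 0 mod m

par : ℕ → Fin 3
par 0             = 0F
par 1             = 1F
par (suc (suc n)) = par n

par-suc : ∀ n → par (suc n) ≢ par n
par-suc 0 ()
par-suc 1 ()
par-suc (suc (suc n)) = par-suc n

par-even : ∀ j → par (2 * j) ≡ 0F
par-even zero    = refl
par-even (suc j) = trans (cong par (*-suc 2 j)) (par-even j)

par-odd : ∀ j → par (1 + 2 * j) ≡ 1F
par-odd zero    = refl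
par-odd (suc j) = trans (cong (par ∘ suc) (*-suc 2 j)) (par-odd j)

-- The colour of the vertex e positions before the end of 0, 1, …, m - 1: colours alternate
-- 0, 1, 0, …, and the last five vertices 2, 1, 2, 0, 2 absorb the odd length across the wrap-around.
colourFromEnd : ℕ → Fin 3
colourFromEnd 0 = 2F
colourFromEnd 1 = 0F
colourFromEnd 2 = 2F
colourFromEnd 3 = 1F
colourFromEnd 4 = 2F
colourFromEnd (suc (suc (suc (suc (suc e))))) = par (suc e)

colourFromEnd-+1 : ∀ e → colourFromEnd (1 + e) ≢ colourFromEnd e
colourFromEnd-+1 0 ()
colourFromEnd-+1 1 ()
colourFromEnd-+1 2 ()
colourFromEnd-+1 3 ()
colourFromEnd-+1 4 ()
colourFromEnd-+1 (suc (suc (suc (suc (suc e))))) = par-suc e ∘ sym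

colourFromEnd-+3 : ∀ e → colourFromEnd (3 + e) ≢ colourFromEnd e
colourFromEnd-+3 0 ()
colourFromEnd-+3 1 ()
colourFromEnd-+3 2 ()
colourFromEnd-+3 3 ()
colourFromEnd-+3 4 ()
colourFromEnd-+3 (suc (suc (suc (suc (suc e))))) = par-suc e ∘ sym

module _ (j : ℕ) where

  private
    m : ℕ
    m = 9 + 2 * j

  colouring : Fin m → Fin 3
  colouring a = colourFromEnd (m ∸ suc (toℕ a))

  colouring-at : ∀ a {e} → toℕ a + suc e ≡ m → colouring a ≡ colourFromEnd e
  colouring-at a {e} gap = cong colourFromEnd (begin
    m ∸ suc (toℕ a)              ≡⟨ cong (_∸ suc (toℕ a)) gap ⟨
    toℕ a + suc e ∸ suc (toℕ a)  ≡⟨ cong (_∸ suc (toℕ a)) (+-suc (toℕ a) e) ⟩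
    toℕ a + e ∸ toℕ a            ≡⟨ m+n∸m≡n (toℕ a) e ⟩
    e                            ∎)
    where open ≡-Reasoning

  colouring-start : ∀ b r → toℕ b ≡ r → colouring b ≡ colourFromEnd (m ∸ suc r)
  colouring-start b r = cong (λ k → colourFromEnd (m ∸ suc k))

  colouring-proper : ProperColouring colouring
  colouring-proper a = proper-at a (m ∸ suc (toℕ a)) (trans (+-suc (toℕ a) _) (m+[n∸m]≡n (toℕ<n a)))
    where
    distinct : {x y c c' : Fin 3} → x ≡ c → y ≡ c' → c ≢ c' → x ≢ y
    distinct refl refl c≢c' = c≢c'

    proper-at : ∀ a e → toℕ a + suc e ≡ m → ∀ {d} → D13 d → colouring a ≢ colouring (a ⊕ d)
    proper-at a 0 gap (inj₁ refl) =
      distinct (colouring-at a gap) (trans (colouring-start (a ⊕ 1) 0 (⊕-across a 0 0 gap (s≤s z≤n))) (par-even j)) λ ()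
    proper-at a (suc e) gap (inj₁ refl) eq =
      colourFromEnd-+1 e (trans (sym (colouring-at a gap)) (trans eq (colouring-at (a ⊕ 1) (⊕-within a 1 e gap))))
    proper-at a 0 gap (inj₂ refl) =
      distinct (colouring-at a gap) (trans (colouring-start (a ⊕ 3) 2 (⊕-across a 0 2 gap (s≤s (s≤s (s≤s z≤n))))) (par-even j)) λ ()
    proper-at a 1 gap (inj₂ refl) =
      distinct (colouring-at a gap) (trans (colouring-start (a ⊕ 3) 1 (⊕-across a 1 1 gap (s≤s (s≤s z≤n)))) (par-odd j)) λ ()
    proper-at a 2 gap (inj₂ refl) =
      distinct (colouring-at a gap) (trans (colouring-start (a ⊕ 3) 0 (⊕-across a 2 0 gap (s≤s z≤n))) (par-even j)) λ ()
    proper-at a (suc (suc (suc e))) gap (inj₂ refl) eq =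
      colourFromEnd-+3 e (trans (sym (colouring-at a gap)) (trans eq (colouring-at (a ⊕ 3) (⊕-within a 3 e gap))))

lemma11 : (m : ℕ) → 13 ≤ m → ¬ (2 ∣ m) →
    (HasCycleFactorization m (L m) ⇔ (¬ (3 ∣ m)))
lemma11 m 13≤m 2∤m with odd⇒≡9+2* (≤-trans (m≤m+n 9 4) 13≤m) 2∤m
... | j , refl = mk⇔
  (λ factorization 3∣m → 3∣⇒¬factorization 2<m (prime∤⇒coprime prime[2] 2∤m) 3∣m factorization)
  (λ 3∤m → colouring⇒factorization (colouring j) (colouring-proper j) 2<m (prime∤⇒coprime prime[3] 3∤m))
  where
  2<m : 2 < 9 + 2 * j
  2<m = s≤s (s≤s (s≤s z≤n))
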